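{- For all words $x,y,z$, $x\neq yxz$.
   Context: Work in a two-sorted first-order theory with equality whose sorts are words (lower-case variables) and systems (upper-case variables), with two word constants $0$ and $1$, a binary concatenation operation on words written by juxtaposition, and a membership relation $x\in S$ between a word and a system. Axioms: (symbols) $0\neq 1$ and $xy\neq 0$, $xy\neq 1$ for all words $x,y$; (associativity) $(xy)z=x(yz)$; (reading) $x0\neq y1$ for all $x,y$; (simplification) if $x_1y_1=x_2y_2$ and $y_1=y_2$ then $x_1=x_2$; (extensionality) two systems with the same elements are equal; (word induction) every system containing $0$ and $1$ and containing $x0$ and $x1$ whenever it contains $x$ contains every word; (comprehension) for every formula $\phi(x,x_1,\dots,x_n,S_1,\dots,S_m)$ in which $S$ is not free, there is a system $S$ with $x\in S\Leftrightarrow\phi$ for all words $x$. -}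

module Defs where

open import Data.Nat using (ℕ; zero; suc)
open import Data.Fin using (Fin)
open import Data.Vec.Functional using (Vector; _∷_)
open import Data.Product using (Σ; _×_; ∃; ∃-syntax)
open import Data.Sum using (_⊎_)
open import Data.Empty using (⊥)
open import Relation.Nullary using (¬_)
open import Relation.Binary.PropositionalEquality using (_≡_; _≢_)

-- Syntax of the two-sorted first-order language (de Bruijn indices):
-- n word variables, m system variables.

infixl 7 _·_
data Term (n : ℕ) : Set where
  var  : Fin n → Term n
  𝟘 𝟙  : Term n
  _·_  : Term n → Term n → Term n

data Formula (n m : ℕ) : Set where
  _≐_    : Term n → Term n → Formula n m
  _≐ˢ_   : Fin m → Fin m → Formula n m
  _∈̇_    : Term n → Fin m → Formula n m
  ⊥̇      : Formula n m
  ¬̇_     : Formula n m → Formula n m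
  _∧̇_ _∨̇_ _⇒̇_ : Formula n m → Formula n m → Formula n m
  ∀w ∃w  : Formula (suc n) m → Formula n m
  ∀s ∃s  : Formula n (suc m) → Formula n m

record Structure : Set₁ where
  infixl 7 _⊙_
  infix 4 _∈_
  field
    Word   : Set
    System : Set
    w0 w1  : Word
    _⊙_    : Word → Word → Word
    _∈_    : Word → System → Set

  ⟦_⟧ₜ : ∀ {n} → Term n → Vector Word n → Word
  ⟦ var i ⟧ₜ ρ = ρ i
  ⟦ 𝟘 ⟧ₜ ρ = w0
  ⟦ 𝟙 ⟧ₜ ρ = w1
  ⟦ s · t ⟧ₜ ρ = ⟦ s ⟧ₜ ρ ⊙ ⟦ t ⟧ₜ ρ

  ⟦_⟧ : ∀ {n m} → Formula n m → Vector Word n → Vector System m → Set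
  ⟦ s ≐ t ⟧ ρ σ = ⟦ s ⟧ₜ ρ ≡ ⟦ t ⟧ₜ ρ
  ⟦ i ≐ˢ j ⟧ ρ σ = σ i ≡ σ j
  ⟦ t ∈̇ i ⟧ ρ σ = ⟦ t ⟧ₜ ρ ∈ σ i
  ⟦ ⊥̇ ⟧ ρ σ = ⊥
  ⟦ ¬̇ φ ⟧ ρ σ = ¬ ⟦ φ ⟧ ρ σ
  ⟦ φ ∧̇ ψ ⟧ ρ σ = ⟦ φ ⟧ ρ σ × ⟦ ψ ⟧ ρ σ
  ⟦ φ ∨̇ ψ ⟧ ρ σ = ⟦ φ ⟧ ρ σ ⊎ ⟦ ψ ⟧ ρ σ
  ⟦ φ ⇒̇ ψ ⟧ ρ σ = ⟦ φ ⟧ ρ σ → ⟦ ψ ⟧ ρ σ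
  ⟦ ∀w φ ⟧ ρ σ = ∀ x → ⟦ φ ⟧ (x ∷ ρ) σ
  ⟦ ∃w φ ⟧ ρ σ = ∃[ x ] ⟦ φ ⟧ (x ∷ ρ) σ
  ⟦ ∀s φ ⟧ ρ σ = ∀ S → ⟦ φ ⟧ ρ (S ∷ σ)
  ⟦ ∃s φ ⟧ ρ σ = ∃[ S ] ⟦ φ ⟧ ρ (S ∷ σ)

record Model : Set₁ where
  field
    structure : Structure
  open Structure structure public
  field
    0≢1        : w0 ≢ w1
    xy≢0       : ∀ x y → x ⊙ y ≢ w0
    xy≢1       : ∀ x y → x ⊙ y ≢ w1
    assoc      : ∀ x y z → (x ⊙ y) ⊙ z ≡ x ⊙ (y ⊙ z)
    reading    : ∀ x y → x ⊙ w0 ≢ y ⊙ w1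
    simplify   : ∀ x₁ y₁ x₂ y₂ → x₁ ⊙ y₁ ≡ x₂ ⊙ y₂ → y₁ ≡ y₂ → x₁ ≡ x₂
    extens     : ∀ S T → (∀ x → (x ∈ S → x ∈ T) × (x ∈ T → x ∈ S)) → S ≡ T
    induction  : ∀ S → w0 ∈ S → w1 ∈ S →
                 (∀ x → x ∈ S → (x ⊙ w0 ∈ S) × (x ⊙ w1 ∈ S)) →
                 ∀ x → x ∈ S
    -- comprehension schema: φ has the distinguished free word variable x
    -- (index 0) and parameters ρ, σ; S is fresh by construction.
    comprehension : ∀ {n m} (φ : Formula (suc n) m)
                    (ρ : Vector Word n) (σ : Vector System m) →
                    Σ System λ S → ∀ x →
                      (x ∈ S → ⟦ φ ⟧ (x ∷ ρ) σ) × (⟦ φ ⟧ (x ∷ ρ) σ → x ∈ S)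

-- The proof is by word induction on x, carried out inside an arbitrary model
-- of the theory.  Induction is only available for systems, so each inductive
-- property is first written as a formula and turned into a system by
-- comprehension (`formulaInduction`).  Two facts about words are needed:
--   * every word is a letter (0 or 1) or ends with a letter (`lastLetter`,
--     itself proved by formula induction), and
--   * a common final letter may be cancelled (`cancelLastLetter`, from the
--     reading and simplification axioms).
-- For the base case, a letter is never a concatenation.  For the step, given
-- xb = y(xb)z write z = c or z = wc with c a letter; reassociating and
-- cancelling the final letters gives x = y(xb) resp. x = y(x(bw)), which the
-- induction hypothesis for x excludes.
module Submission where

open import Defs
open import Axiom.ExcludedMiddle using (ExcludedMiddle)
open import Relation.Binary.PropositionalEquality
open import Level using (0ℓ)
open import Data.Fin using (zero; suc)
open import Data.Product using (Σ; _×_; _,_; proj₁; proj₂; ∃₂)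
open import Data.Sum using (_⊎_; inj₁; inj₂)
open import Data.Empty using (⊥-elim)
open import Data.Vec.Functional using (_∷_)

module WordFacts (M : Model) where
  open Model M

  formulaInduction : (φ : Formula 1 0) →
                     let P = λ x → ⟦ φ ⟧ (x ∷ (λ ())) (λ ()) in
                     P w0 → P w1 → (∀ x → P x → P (x ⊙ w0) × P (x ⊙ w1)) →
                     ∀ x → P x
  formulaInduction φ base₀ base₁ step x =
    proj₁ (defines x) (induction S (proj₂ (defines w0) base₀)
                                   (proj₂ (defines w1) base₁)
                                   closed x)
    where
    S = proj₁ (comprehension φ (λ ()) (λ ()))
    defines = proj₂ (comprehension φ (λ ()) (λ ()))

    closed : ∀ x → x ∈ S → (x ⊙ w0 ∈ S) × (x ⊙ w1 ∈ S)
    closed x x∈S = proj₂ (defines (x ⊙ w0)) (proj₁ next) ,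
                   proj₂ (defines (x ⊙ w1)) (proj₂ next)
      where next = step x (proj₁ (defines x) x∈S)

  Letter : Word → Set
  Letter b = b ≡ w0 ⊎ b ≡ w1

  lastLetter : ∀ z → Letter z ⊎ ∃₂ λ w c → Letter c × z ≡ w ⊙ c
  lastLetter z = normalise (formulaInduction shape
                   (inj₁ (inj₁ refl)) (inj₁ (inj₂ refl))
                   (λ x _ → inj₂ (x , inj₁ refl) , inj₂ (x , inj₂ refl)) z)
    where
    shape : Formula 1 0
    shape = ((var zero ≐ 𝟘) ∨̇ (var zero ≐ 𝟙)) ∨̇
            ∃w ((var (suc zero) ≐ (var zero · 𝟘)) ∨̇ (var (suc zero) ≐ (var zero · 𝟙)))

    normalise : Letter z ⊎ Σ Word (λ w → z ≡ w ⊙ w0 ⊎ z ≡ w ⊙ w1) →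
                Letter z ⊎ ∃₂ λ w c → Letter c × z ≡ w ⊙ c
    normalise (inj₁ z-letter)          = inj₁ z-letter
    normalise (inj₂ (w , inj₁ z≡w0)) = inj₂ (w , w0 , inj₁ refl , z≡w0)
    normalise (inj₂ (w , inj₂ z≡w1)) = inj₂ (w , w1 , inj₂ refl , z≡w1)

  cancelLastLetter : ∀ {x u b c} → Letter b → Letter c → x ⊙ b ≡ u ⊙ c → x ≡ u
  cancelLastLetter (inj₁ refl) (inj₁ refl) e = simplify _ _ _ _ e refl
  cancelLastLetter (inj₂ refl) (inj₂ refl) e = simplify _ _ _ _ e refl
  cancelLastLetter (inj₁ refl) (inj₂ refl) e = ⊥-elim (reading _ _ e)
  cancelLastLetter (inj₂ refl) (inj₁ refl) e = ⊥-elim (reading _ _ (sym e))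

  regroup : ∀ x y b w c → y ⊙ ((x ⊙ b) ⊙ (w ⊙ c)) ≡ (y ⊙ (x ⊙ (b ⊙ w))) ⊙ c
  regroup x y b w c = begin
    y ⊙ ((x ⊙ b) ⊙ (w ⊙ c))   ≡⟨ cong (y ⊙_) (assoc x b (w ⊙ c)) ⟩
    y ⊙ (x ⊙ (b ⊙ (w ⊙ c)))   ≡⟨ cong (λ t → y ⊙ (x ⊙ t)) (sym (assoc b w c)) ⟩
    y ⊙ (x ⊙ ((b ⊙ w) ⊙ c))   ≡⟨ cong (y ⊙_) (sym (assoc x (b ⊙ w) c)) ⟩
    y ⊙ ((x ⊙ (b ⊙ w)) ⊙ c)   ≡⟨ sym (assoc y (x ⊙ (b ⊙ w)) c) ⟩
    (y ⊙ (x ⊙ (b ⊙ w))) ⊙ c   ∎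
    where open ≡-Reasoning

  NotSelfInfix : Word → Set
  NotSelfInfix x = ∀ y z → x ≢ y ⊙ (x ⊙ z)

  appendLetter : ∀ x b → Letter b → NotSelfInfix x → NotSelfInfix (x ⊙ b)
  appendLetter x b b-letter ih y z eq with lastLetter z
  ... | inj₁ z-letter =
    ih y b (cancelLastLetter b-letter z-letter
              (trans eq (sym (assoc y (x ⊙ b) z))))
  ... | inj₂ (w , c , c-letter , refl) =
    ih y (b ⊙ w) (cancelLastLetter b-letter c-letter
                    (trans eq (regroup x y b w c)))

  notSelfInfix : ∀ x → NotSelfInfix x
  notSelfInfix = formulaInduction property
    (λ y z e → xy≢0 _ _ (sym e))
    (λ y z e → xy≢1 _ _ (sym e))
    (λ x ih → appendLetter x w0 (inj₁ refl) ih , appendLetter x w1 (inj₂ refl) ih)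
    where
    property : Formula 1 0
    property = ∀w (∀w (¬̇ (var (suc (suc zero)) ≐
                          (var (suc zero) · (var (suc (suc zero)) · var zero)))))

mainTheorem12 : ExcludedMiddle 0ℓ → (M : Model) →
    let open Model M in
    ∀ x y z → x ≢ y ⊙ (x ⊙ z)
mainTheorem12 _ M = WordFacts.notSelfInfix M
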